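{- Let $k\ge 3$ and let $G$ be a finite $k$-uniform hypergraph. Then there is a picture $\Pi_0=(P_0, \psi_0)$ over $G$ together with a family $(L_e)_{e\in E(G)}$ of mutually disjoint combinatorial lines such that $P_0=\bigcup_{e\in E(G)}L_e$ and $\psi_0[L_e]=e$ for every $e\in E(G)$.
   Context: A combinatorial line in $[k]^m$ is the image of a map $\eta\colon[k]\to[k]^m$ for which there is a partition $[m]=C\cup M$ with $M\neq\emptyset$ such that, writing $\eta(i)=(u_{i1},\dots,u_{im})$, we have $u_{1c}=\dots=u_{kc}$ for $c\in C$ and $u_{ij}=i$ for $i\in[k]$, $j\in M$. A quasiline in $[k]^m$ is a $k$-element subset such that for every coordinate the entries of its points in that coordinate are either all identical or mutually distinct. For a $k$-uniform hypergraph $G$ with $k\ge3$, a picture over $G$ is a pair $\Pi=(P,\psi)$ consisting of a subset $P\subseteq[k]^m$ for some $m$ and a map $\psi\colon P\to V(G)$ such that every quasiline $L\subseteq P$ is a combinatorial line satisfying $\psi[L]\in E(G)$. -}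

module Defs where

open import Data.Nat using (ℕ; _≤_)
open import Data.Fin using (Fin)
open import Data.Fin.Subset using (Subset; ∣_∣; _∈_)
open import Data.Vec using (Vec; lookup; tabulate)
open import Data.Maybe using (Maybe; nothing; fromMaybe)
open import Data.Bool using (Bool; T)
open import Data.Product using (Σ; ∃; ∃-syntax; _×_)
open import Data.Sum using (_⊎_)
open import Relation.Nullary using (¬_)
open import Relation.Binary.PropositionalEquality using (_≡_)
open import Function.Bundles using (_⇔_)

record Hypergraph (k : ℕ) : Set where
  field
    nV       : ℕ
    nE       : ℕ
    edge     : Fin nE → Subset nV
    uniform  : ∀ e → ∣ edge e ∣ ≡ k
    distinct : ∀ e e′ → edge e ≡ edge e′ → e ≡ e′

Point : ℕ → ℕ → Set
Point m k = Vec (Fin k) m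

-- A combinatorial line is given by a word w : coordinates in C carry a constant
-- (just c), coordinates in M carry nothing (the moving coordinates), M ≠ ∅.
record LineWord (m k : ℕ) : Set where
  field
    word   : Vec (Maybe (Fin k)) m
    moving : ∃[ j ] lookup word j ≡ nothing

η : ∀ {m k} → LineWord m k → Fin k → Point m k
η w i = tabulate (λ j → fromMaybe i (lookup (LineWord.word w) j))

-- A k-element subset of [k]^m, given by an injective enumeration q : Fin k → Point,
-- is a quasiline if in every coordinate the entries are all equal or pairwise distinct.
IsQuasiline : ∀ {m k} → (Fin k → Point m k) → Set
IsQuasiline {m} {k} q =
  (∀ a b → q a ≡ q b → a ≡ b) ×
  (∀ (j : Fin m) → (∀ a b → lookup (q a) j ≡ lookup (q b) j)
                 ⊎ (∀ a b → lookup (q a) j ≡ lookup (q b) j → a ≡ b))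

IsCombLine : ∀ {m k} → (Fin k → Point m k) → Set
IsCombLine {m} {k} q =
  ∃[ w ] ((∀ a → ∃[ i ] q a ≡ η w i) × (∀ i → ∃[ a ] η w i ≡ q a))

-- A picture over G: a subset P ⊆ [k]^m (decidable, as a Bool predicate) and a map
-- ψ : P → V(G), such that every quasiline L ⊆ P is a combinatorial line with ψ[L] ∈ E(G).
IsPicture : ∀ {k} (G : Hypergraph k) {m} (P : Point m k → Bool)
            (ψ : (x : Point m k) → T (P x) → Fin (Hypergraph.nV G)) → Set
IsPicture {k} G {m} P ψ =
  (q : Fin k → Point m k) → IsQuasiline q → (sub : ∀ a → T (P (q a))) →
    IsCombLine q ×
    ∃[ e ] (∀ v → (v ∈ Hypergraph.edge G e) ⇔ (∃[ a ] ψ (q a) (sub a) ≡ v))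

{-# OPTIONS --safe #-}
module Submission where

-- Take m = 1 + |E(G)| and let the line L_e move in coordinate 0 while coordinate 1 + c is
-- constantly 1 if c = e and 0 otherwise; ψ sends the i-th point of L_e to the i-th vertex of e.
-- A quasiline inside P = ⋃ L_e sees, in the indicator coordinate of the line through one of its
-- points, only the two values 0 and 1; as k ≥ 3 these cannot be pairwise distinct, so they are
-- constant, which forces every point onto that same line. An injective k-point subset of a line
-- is the whole line, so the quasiline is L_e and ψ maps it onto e.

open import Defs
open import Data.Nat using (ℕ; _≤_; _<_; suc)
open import Data.Nat.Properties using (<⇒≤; n<1+n)
open import Data.Fin using (Fin; zero; suc; inject≤; cast; punchOut; toℕ; _≟_)
open import Data.Fin.Properties
  using (any?; <⇒notInjective; punchOut-injective; toℕ-injective; toℕ-inject≤; cast-involutive)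
open import Data.Fin.Subset using (Subset; _∈_; ∣_∣)
open import Data.Vec using (_∷_; lookup; tabulate; here; there)
open import Data.Vec.Properties using (lookup∘tabulate; ≡-dec)
open import Data.Maybe using (nothing; just; fromMaybe)
open import Data.Bool using (Bool; T; true; false)
open import Data.Product using (Σ; ∃; ∃-syntax; _×_; _,_; proj₁; proj₂)
open import Data.Sum using (inj₁; inj₂)
open import Data.Empty using (⊥-elim)
open import Function.Bundles using (_⇔_; mk⇔; Equivalence)
open import Function.Definitions using (Injective)
open import Relation.Nullary using (¬_; Dec; yes; no; contradiction)
open import Relation.Nullary.Decidable using (isYes; toWitness; fromWitness)
open import Relation.Binary.PropositionalEquality
  using (_≡_; _≢_; refl; sym; trans; cong; cong₂; subst; module ≡-Reasoning)

enumerate : ∀ {n} (s : Subset n) → Fin ∣ s ∣ → Fin n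
enumerate (true  ∷ s) zero    = zero
enumerate (true  ∷ s) (suc i) = suc (enumerate s i)
enumerate (false ∷ s) i       = suc (enumerate s i)

enumerate-∈ : ∀ {n} (s : Subset n) (i : Fin ∣ s ∣) → enumerate s i ∈ s
enumerate-∈ (true  ∷ s) zero    = here
enumerate-∈ (true  ∷ s) (suc i) = there (enumerate-∈ s i)
enumerate-∈ (false ∷ s) i       = there (enumerate-∈ s i)

enumerate-surjective : ∀ {n} (s : Subset n) {v : Fin n} → v ∈ s → ∃[ i ] enumerate s i ≡ v
enumerate-surjective (true  ∷ s) here      = zero , refl
enumerate-surjective (true  ∷ s) (there v∈s) with i , eq ← enumerate-surjective s v∈s =
  suc i , cong suc eq
enumerate-surjective (false ∷ s) (there v∈s) with i , eq ← enumerate-surjective s v∈s =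
  i , cong suc eq

injective⇒surjective : ∀ {n} {f : Fin n → Fin n} → Injective _≡_ _≡_ f → ∀ y → ∃[ x ] f x ≡ y
injective⇒surjective {suc n} {f} f-injective y with any? (λ x → f x ≟ y)
... | yes hit = hit
... | no miss = ⊥-elim (<⇒notInjective (n<1+n n) squeeze-injective)
  where
  y≢f : ∀ x → y ≢ f x
  y≢f x y≡fx = miss (x , sym y≡fx)

  squeeze : Fin (suc n) → Fin n
  squeeze x = punchOut (y≢f x)

  squeeze-injective : Injective _≡_ _≡_ squeeze
  squeeze-injective eq = f-injective (punchOut-injective (y≢f _) (y≢f _) eq)

injective⇒covers-line : ∀ {m k} {w : LineWord m k} {q : Fin k → Point m k} {ι : Fin k → Fin k} →
  (∀ a b → q a ≡ q b → a ≡ b) → (∀ a → q a ≡ η w (ι a)) → ∀ i → ∃[ a ] η w i ≡ q a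
injective⇒covers-line {w = w} {q} {ι} q-injective q-on-w i =
  let a , ιa≡i = injective⇒surjective ι-injective i in
  a , trans (cong (η w) (sym ιa≡i)) (sym (q-on-w a))
  where
  ι-injective : Injective _≡_ _≡_ ι
  ι-injective {a} {b} eq = q-injective a b (trans (q-on-w a) (trans (cong (η w) eq) (sym (q-on-w b))))

module Construction {k} (2<k : 2 < k) (G : Hypergraph k) where
  open Hypergraph G

  bit : Fin 2 → Fin k
  bit b = inject≤ b (<⇒≤ 2<k)

  bit-injective : Injective _≡_ _≡_ bit
  bit-injective {b} {b′} eq =
    toℕ-injective (trans (sym (toℕ-inject≤ b _)) (trans (cong toℕ eq) (toℕ-inject≤ b′ _)))

  indicator : Fin nE → Fin nE → Fin 2
  indicator e c with e ≟ c
  ... | yes _ = suc zero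
  ... | no  _ = zero

  indicator-self : ∀ e → indicator e e ≡ suc zero
  indicator-self e with e ≟ e
  ... | yes _   = refl
  ... | no  e≢e = contradiction refl e≢e

  indicator⁻¹ : ∀ {e c} → indicator e c ≡ suc zero → e ≡ c
  indicator⁻¹ {e} {c} eq with e ≟ c
  ... | yes e≡c = e≡c

  line : Fin nE → LineWord (suc nE) k
  line e = record
    { word   = nothing ∷ tabulate (λ c → just (bit (indicator e c)))
    ; moving = zero , refl
    }

  lookup-line-tag : ∀ e i c → lookup (η (line e) i) (suc c) ≡ bit (indicator e c)
  lookup-line-tag e i c = trans (lookup∘tabulate _ c) (cong (fromMaybe i) (lookup∘tabulate _ c))

  line-injective : ∀ {e e′ i i′} → η (line e) i ≡ η (line e′) i′ → e ≡ e′ × i ≡ i′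
  line-injective {e} {e′} {i} {i′} eq =
    sym (indicator⁻¹ (bit-injective e′-tag)) , cong (λ x → lookup x zero) eq
    where
    open ≡-Reasoning
    e′-tag : bit (indicator e′ e) ≡ bit (suc zero)
    e′-tag = begin
      bit (indicator e′ e)              ≡⟨ sym (lookup-line-tag e′ i′ e) ⟩
      lookup (η (line e′) i′) (suc e)   ≡⟨ cong (λ x → lookup x (suc e)) (sym eq) ⟩
      lookup (η (line e) i) (suc e)     ≡⟨ lookup-line-tag e i e ⟩
      bit (indicator e e)               ≡⟨ cong bit (indicator-self e) ⟩
      bit (suc zero)                    ∎

  OnLines : Point (suc nE) k → Set
  OnLines x = ∃[ e ] ∃[ i ] x ≡ η (line e) i

  onLines? : ∀ x → Dec (OnLines x)
  onLines? x = any? (λ e → any? (λ i → ≡-dec _≟_ x (η (line e) i)))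

  P : Point (suc nE) k → Bool
  P x = isYes (onLines? x)

  P⇔OnLines : ∀ x → T (P x) ⇔ OnLines x
  P⇔OnLines x = mk⇔ toWitness fromWitness

  vertex : Fin nE → Fin k → Fin nV
  vertex e i = enumerate (edge e) (cast (sym (uniform e)) i)

  vertex-image : ∀ e v → v ∈ edge e ⇔ (∃[ i ] vertex e i ≡ v)
  vertex-image e v = mk⇔ to from
    where
    to : v ∈ edge e → ∃[ i ] vertex e i ≡ v
    to v∈e with j , eq ← enumerate-surjective (edge e) v∈e =
      cast (uniform e) j ,
      trans (cong (enumerate (edge e)) (cast-involutive (sym (uniform e)) (uniform e) j)) eq
    from : ∃[ i ] vertex e i ≡ v → v ∈ edge e
    from (i , eq) = subst (_∈ edge e) eq (enumerate-∈ (edge e) _)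

  ψ : (x : Point (suc nE) k) → T (P x) → Fin nV
  ψ x p with e , i , _ ← toWitness p = vertex e i

  ψ-line : ∀ {x} (p : T (P x)) {e i} → x ≡ η (line e) i → ψ x p ≡ vertex e i
  ψ-line p x≡ with e′ , i′ , x≡′ ← toWitness p =
    let e′≡e , i′≡i = line-injective (trans (sym x≡′) x≡) in cong₂ vertex e′≡e i′≡i

  lines-disjoint : ∀ e e′ → ¬ e ≡ e′ → ∀ i i′ → ¬ η (line e) i ≡ η (line e′) i′
  lines-disjoint e e′ e≢e′ i i′ eq = e≢e′ (proj₁ (line-injective eq))

  line-image : ∀ e v → v ∈ edge e ⇔ (∃[ i ] Σ (T (P (η (line e) i))) λ p → ψ (η (line e) i) p ≡ v)
  line-image e v = mk⇔ to from
    where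
    to : v ∈ edge e → ∃[ i ] Σ (T (P (η (line e) i))) λ p → ψ (η (line e) i) p ≡ v
    to v∈e =
      let i , eq = Equivalence.to (vertex-image e v) v∈e
          p = fromWitness (e , i , refl)
      in i , p , trans (ψ-line p refl) eq
    from : (∃[ i ] Σ (T (P (η (line e) i))) λ p → ψ (η (line e) i) p ≡ v) → v ∈ edge e
    from (i , p , eq) = Equivalence.from (vertex-image e v) (i , trans (sym (ψ-line p refl)) eq)

  module _ {q : Fin k → Point (suc nE) k} (loc : ∀ a → OnLines (q a)) where
    edgeOf : Fin k → Fin nE
    edgeOf a = proj₁ (loc a)

    lookup-tag : ∀ a c → lookup (q a) (suc c) ≡ bit (indicator (edgeOf a) c)
    lookup-tag a c with e , i , qa≡ ← loc a =
      trans (cong (λ x → lookup x (suc c)) qa≡) (lookup-line-tag e i c)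

    quasiline-within-one-line : IsQuasiline q → ∀ a b → edgeOf a ≡ edgeOf b
    quasiline-within-one-line (_ , constant-or-distinct) a b
      with constant-or-distinct (suc (edgeOf b))
    ... | inj₁ constant = indicator⁻¹ (bit-injective (begin
      bit (indicator (edgeOf a) (edgeOf b))   ≡⟨ sym (lookup-tag a _) ⟩
      lookup (q a) (suc (edgeOf b))           ≡⟨ constant a b ⟩
      lookup (q b) (suc (edgeOf b))           ≡⟨ lookup-tag b _ ⟩
      bit (indicator (edgeOf b) (edgeOf b))   ≡⟨ cong bit (indicator-self _) ⟩
      bit (suc zero)                          ∎))
      where open ≡-Reasoning
    ... | inj₂ distinct = ⊥-elim (<⇒notInjective 2<k tag-injective)
      where
      tag-injective : Injective _≡_ _≡_ (λ x → indicator (edgeOf x) (edgeOf b))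
      tag-injective {x} {y} eq =
        distinct x y (trans (lookup-tag x _) (trans (cong bit eq) (sym (lookup-tag y _))))

  picture : IsPicture G P ψ
  picture q quasiline@(q-injective , _) sub =
    (line e , (λ a → ι a , q-on-line a) , covered) , e , λ v → mk⇔ (to v) (from v)
    where
    loc : ∀ a → OnLines (q a)
    loc a = toWitness (sub a)

    -- bit zero is merely some index, available since k ≥ 3.
    e : Fin nE
    e = edgeOf loc (bit zero)

    ι : Fin k → Fin k
    ι a = proj₁ (proj₂ (loc a))

    q-on-line : ∀ a → q a ≡ η (line e) (ι a)
    q-on-line a = subst (λ e′ → q a ≡ η (line e′) (ι a))
      (quasiline-within-one-line loc quasiline a (bit zero)) (proj₂ (proj₂ (loc a)))

    covered : ∀ i → ∃[ a ] η (line e) i ≡ q a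
    covered = injective⇒covers-line {w = line e} q-injective q-on-line

    to : ∀ v → v ∈ edge e → ∃[ a ] ψ (q a) (sub a) ≡ v
    to v v∈e =
      let i , eq = Equivalence.to (vertex-image e v) v∈e
          a , line≡q = covered i
      in a , trans (ψ-line (sub a) (sym line≡q)) eq

    from : ∀ v → ∃[ a ] ψ (q a) (sub a) ≡ v → v ∈ edge e
    from v (a , eq) =
      Equivalence.from (vertex-image e v) (ι a , trans (sym (ψ-line (sub a) (q-on-line a))) eq)

lemma4p3 : (k : ℕ) → 3 ≤ k → (G : Hypergraph k) →
    ∃[ m ] Σ (Point m k → Bool) λ P →
      Σ ((x : Point m k) → T (P x) → Fin (Hypergraph.nV G)) λ ψ →
        IsPicture G P ψ ×
        Σ (Fin (Hypergraph.nE G) → LineWord m k) λ L →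
          (∀ e e′ → ¬ e ≡ e′ → ∀ i i′ → ¬ η (L e) i ≡ η (L e′) i′) ×
          (∀ x → T (P x) ⇔ (∃[ e ] ∃[ i ] x ≡ η (L e) i)) ×
          (∀ e → ∀ v → (v ∈ Hypergraph.edge G e) ⇔
                 (∃[ i ] Σ (T (P (η (L e) i))) λ p → ψ (η (L e) i) p ≡ v))
lemma4p3 k 2<k G = _ , P , ψ , picture , line , lines-disjoint , P⇔OnLines , line-image
  where open Construction 2<k G
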